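{- Let $a\le 0$ be an integer. Define $b_{\mathcal{M}}(n)$, $n\ge0$, by $b_{\mathcal{M}}(0)=1$, $b_{\mathcal{M}}(1)=-1$, $b_{\mathcal{M}}(2)=a$ and, for $n\ge3$, $b_{\mathcal{M}}(n)=-\frac{1}{2}\sum_{k=0}^{n-1}b_{\mathcal{M}}(k)\binom{n+1}{k+1}$. For integers $0\le j\le d$ set $$s_{\mathcal{M}}(j,d)=\sum_{k=j}^d\frac{1}{k+1}\binom{d-j}{d-k}b_{\mathcal{M}}(k).$$ Then for all $d\ge0$ and $0\le j\le d$, $s_{\mathcal{M}}(j,d)=(-1)^ds_{\mathcal{M}}(d-j,d)$. -}

module Defs where

open import Data.Nat as ℕ using (ℕ; zero; suc; _∸_; _≟_)
open import Data.Nat.Combinatorics using (_C_)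
open import Data.Integer as ℤ using (ℤ; +_)
open import Data.Rational using (ℚ; _/_; _+_; _*_; -_; ½; 0ℚ; 1ℚ)
open import Relation.Nullary using (yes; no)

ℕ→ℚ : ℕ → ℚ
ℕ→ℚ n = + n / 1

ℤ→ℚ : ℤ → ℚ
ℤ→ℚ z = z / 1

sumBelow : ℕ → (ℕ → ℚ) → ℚ
sumBelow zero    f = 0ℚ
sumBelow (suc n) f = sumBelow n f + f n

-- Σ_{k=j}^{d} f k  (empty, i.e. 0, if d < j)
sumFromTo : ℕ → ℕ → (ℕ → ℚ) → ℚ
sumFromTo j d f = sumBelow (suc d ∸ j) (λ i → f (j ℕ.+ i))

signPow : ℕ → ℚ
signPow zero    = 1ℚ
signPow (suc d) = - signPow d

-- value of b_M(n), given a table f holding b_M(k) for k < n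
bStep : ℤ → ℕ → (ℕ → ℚ) → ℚ
bStep a 0 f = 1ℚ
bStep a 1 f = - 1ℚ
bStep a 2 f = ℤ→ℚ a
bStep a n@(suc (suc (suc _))) f =
  - (½ * sumBelow n (λ k → f k * ℕ→ℚ (suc n C suc k)))

-- bTable a n k = b_M(k) for all k < n (course-of-values recursion)
bTable : ℤ → ℕ → ℕ → ℚ
bTable a zero    k = 0ℚ
bTable a (suc n) k with k ≟ n
... | yes _ = bStep a n (bTable a n)
... | no  _ = bTable a n k

bM : ℤ → ℕ → ℚ
bM a n = bTable a (suc n) n

sM : ℤ → ℕ → ℕ → ℚ
sM a j d = sumFromTo j d (λ k → (+ 1 / suc k) * ℕ→ℚ ((d ∸ j) C (d ∸ k)) * bM a k)

module Submission where

-- Put c(k) = b(k)/(k+1) and T(j,m) = Σ_{i ≤ m} (m choose i) c(j+i), so that s(j, j+m) = T(j,m).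
-- Pascal's rule gives T(j,m+1) = T(j,m) + T(j+1,m), and hence the same rule for the defect
-- U(j,m) = T(j,m) − (−1)^{j+m} T(m,j), which moreover satisfies U(j,m) = −(−1)^{j+m} U(m,j).
-- We show U vanishes by induction on the level j + m. If level n vanishes, Pascal's rule makes U
-- constant on level N = n+1, with value U(N,0) = U(0,N). For N even antisymmetry forces this
-- value to be 0; for N odd, U(N,0) = c(N) + T(0,N), and absorption
-- (N choose i)/(i+1) = (N+1 choose i+1)/(N+1) turns this into a multiple of
-- b(N) + ½ Σ_{k<N} (N+1 choose k+1) b(k), which is 0 by the recurrence defining b.

open import Defs
open import Data.Nat as ℕ using (ℕ; zero; suc; _≤_; _<_; _∸_; z≤n; s≤s)
import Data.Nat.Properties as ℕP
import Data.Nat.Tactic.RingSolver as ℕ-Solver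
open import Data.Nat.Combinatorics
  using (_C_; nCk+nC[k+1]≡[n+1]C[k+1]; nCk≡nC[n∸k]; nC1≡n; nCn≡1; k>n⇒nCk≡0)
import Data.Nat.Coprimality as Coprime
open import Data.Integer as ℤ using (ℤ; 0ℤ; +_) renaming (_≤_ to _≤ℤ_)
import Data.Integer.Properties as ℤP
open import Data.Rational using (ℚ; mkℚ; _/_; 1/_; _+_; _*_; _-_; -_; 0ℚ; 1ℚ; ½)
import Data.Rational.Properties as ℚP
open import Data.Product using (_,_)
open import Data.Sum using (_⊎_; inj₁; inj₂; [_,_]′)
open import Data.Empty using (⊥-elim)
open import Relation.Nullary using (yes; no)
open import Relation.Nullary.Decidable using (dec⇒maybe)
open import Relation.Binary.PropositionalEquality
open import Tactic.RingSolver using (solve-∀)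
open import Tactic.RingSolver.Core.AlmostCommutativeRing
  using (AlmostCommutativeRing; fromCommutativeRing)

open ≡-Reasoning

ℚ-ring : AlmostCommutativeRing _ _
ℚ-ring = fromCommutativeRing ℚP.+-*-commutativeRing (λ x → dec⇒maybe (0ℚ ℚP.≟ x))

ℕ→ℚ≡mkℚ : ∀ n → ℕ→ℚ n ≡ mkℚ (+ n) 0 (Coprime.sym (Coprime.1-coprimeTo n))
ℕ→ℚ≡mkℚ n = ℚP.↥p/↧p≡p _

-- On normal forms with denominator 1, ℚ's _+_ and _*_ compute to (m·1 + n·1)/1 and (m·n)/1.
ℕ→ℚ-homo-+ : ∀ m n → ℕ→ℚ (m ℕ.+ n) ≡ ℕ→ℚ m + ℕ→ℚ n
ℕ→ℚ-homo-+ m n = begin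
  + (m ℕ.+ n) / 1                   ≡⟨ cong (_/ 1) (ℤP.pos-+ m n) ⟩
  (+ m ℤ.+ + n) / 1                 ≡⟨ cong₂ (λ x y → (x ℤ.+ y) / 1) (ℤP.*-identityʳ (+ m)) (ℤP.*-identityʳ (+ n)) ⟨
  (+ m ℤ.* + 1 ℤ.+ + n ℤ.* + 1) / 1 ≡⟨ cong₂ _+_ (ℕ→ℚ≡mkℚ m) (ℕ→ℚ≡mkℚ n) ⟨
  ℕ→ℚ m + ℕ→ℚ n                     ∎

ℕ→ℚ-homo-* : ∀ m n → ℕ→ℚ (m ℕ.* n) ≡ ℕ→ℚ m * ℕ→ℚ n
ℕ→ℚ-homo-* m n = trans (cong (_/ 1) (ℤP.pos-* m n)) (sym (cong₂ _*_ (ℕ→ℚ≡mkℚ m) (ℕ→ℚ≡mkℚ n)))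

1/[1+k]*[1+k]≡1 : ∀ k → (+ 1 / suc k) * ℕ→ℚ (suc k) ≡ 1ℚ
1/[1+k]*[1+k]≡1 k = begin
  (+ 1 / suc k) * ℕ→ℚ (suc k) ≡⟨ cong₂ _*_ (ℚP.↥p/↧p≡p (mkℚ (+ 1) k (Coprime.1-coprimeTo (suc k)))) (ℕ→ℚ≡mkℚ (suc k)) ⟩
  1/ p * p                    ≡⟨ ℚP.*-inverseˡ p ⟩
  1ℚ                          ∎
  where p = mkℚ (+ suc k) 0 (Coprime.sym (Coprime.1-coprimeTo (suc k)))

[1+k]*[1+n]C[1+k]≡[1+n]*nCk : ∀ n k → suc k ℕ.* (suc n C suc k) ≡ suc n ℕ.* (n C k)
[1+k]*[1+n]C[1+k]≡[1+n]*nCk zero zero = refl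
[1+k]*[1+n]C[1+k]≡[1+n]*nCk zero (suc k) = begin
  suc (suc k) ℕ.* (1 C suc (suc k)) ≡⟨ cong (suc (suc k) ℕ.*_) (k>n⇒nCk≡0 {1} {suc (suc k)} (s≤s (s≤s z≤n))) ⟩
  suc (suc k) ℕ.* 0                 ≡⟨ ℕP.*-zeroʳ (suc (suc k)) ⟩
  0                                 ≡⟨ cong (1 ℕ.*_) (k>n⇒nCk≡0 {0} {suc k} (s≤s z≤n)) ⟨
  1 ℕ.* (0 C suc k)                 ∎
[1+k]*[1+n]C[1+k]≡[1+n]*nCk (suc n) zero = begin
  1 ℕ.* (suc (suc n) C 1) ≡⟨ ℕP.*-identityˡ _ ⟩
  suc (suc n) C 1         ≡⟨ nC1≡n (suc (suc n)) ⟩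
  suc (suc n)             ≡⟨ ℕP.*-identityʳ (suc (suc n)) ⟨
  suc (suc n) ℕ.* 1       ∎
[1+k]*[1+n]C[1+k]≡[1+n]*nCk (suc n) (suc k) = begin
  suc (suc k) ℕ.* (suc N C suc (suc k))
    ≡⟨ cong (suc (suc k) ℕ.*_) (nCk+nC[k+1]≡[n+1]C[k+1] N (suc k)) ⟨
  suc (suc k) ℕ.* (A ℕ.+ B)
    ≡⟨ split k A B ⟩
  A ℕ.+ suc k ℕ.* A ℕ.+ suc (suc k) ℕ.* B
    ≡⟨ cong₂ (λ x y → A ℕ.+ x ℕ.+ y) ([1+k]*[1+n]C[1+k]≡[1+n]*nCk n k) ([1+k]*[1+n]C[1+k]≡[1+n]*nCk n (suc k)) ⟩
  A ℕ.+ N ℕ.* (n C k) ℕ.+ N ℕ.* (n C suc k)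
    ≡⟨ ℕP.+-assoc A _ _ ⟩
  A ℕ.+ (N ℕ.* (n C k) ℕ.+ N ℕ.* (n C suc k))
    ≡⟨ cong (A ℕ.+_) (ℕP.*-distribˡ-+ N (n C k) (n C suc k)) ⟨
  A ℕ.+ N ℕ.* (n C k ℕ.+ n C suc k)
    ≡⟨ cong (λ x → A ℕ.+ N ℕ.* x) (nCk+nC[k+1]≡[n+1]C[k+1] n k) ⟩
  suc N ℕ.* A
    ∎
  where
  N = suc n
  A = N C suc k
  B = N C suc (suc k)
  split : ∀ k A B → suc (suc k) ℕ.* (A ℕ.+ B) ≡ A ℕ.+ suc k ℕ.* A ℕ.+ suc (suc k) ℕ.* B
  split = ℕ-Solver.solve-∀

signPow-square : ∀ n → signPow n * signPow n ≡ 1ℚ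
signPow-square zero    = refl
signPow-square (suc n) = trans (neg*neg (signPow n)) (signPow-square n)
  where
  neg*neg : ∀ s → - s * - s ≡ s * s
  neg*neg = solve-∀ ℚ-ring

signPow-±1 : ∀ n → signPow n ≡ 1ℚ ⊎ signPow n ≡ - 1ℚ
signPow-±1 zero = inj₁ refl
signPow-±1 (suc n) with signPow-±1 n
... | inj₁ s≡1  = inj₂ (cong -_ s≡1)
... | inj₂ s≡-1 = inj₁ (cong -_ s≡-1)

x≡-x⇒x≡0 : ∀ {x} → x ≡ - x → x ≡ 0ℚ
x≡-x⇒x≡0 {x} x≡-x = begin
  x            ≡⟨ halve x ⟩
  ½ * (x + x)  ≡⟨ cong (λ y → ½ * (x + y)) x≡-x ⟩
  ½ * (x - x)  ≡⟨ cancel x ⟩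
  0ℚ           ∎
  where
  halve : ∀ x → x ≡ ½ * (x + x)
  halve = solve-∀ ℚ-ring
  cancel : ∀ x → ½ * (x - x) ≡ 0ℚ
  cancel = solve-∀ ℚ-ring

sumBelow-cong : ∀ K {f g : ℕ → ℚ} → (∀ i → i < K → f i ≡ g i) → sumBelow K f ≡ sumBelow K g
sumBelow-cong zero    f≡g = refl
sumBelow-cong (suc K) f≡g =
  cong₂ _+_ (sumBelow-cong K (λ i i<K → f≡g i (ℕP.m<n⇒m<1+n i<K))) (f≡g K (ℕP.n<1+n K))

*-distribˡ-sumBelow : ∀ K v (f : ℕ → ℚ) → v * sumBelow K f ≡ sumBelow K (λ i → v * f i)
*-distribˡ-sumBelow zero    v f = ℚP.*-zeroʳ v
*-distribˡ-sumBelow (suc K) v f =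
  trans (ℚP.*-distribˡ-+ v (sumBelow K f) (f K)) (cong (_+ v * f K) (*-distribˡ-sumBelow K v f))

module BinomialTransform (c : ℕ → ℚ) where

  partialT : ℕ → ℕ → ℕ → ℚ
  partialT j m K = sumBelow K (λ i → ℕ→ℚ (m C i) * c (j ℕ.+ i))

  T : ℕ → ℕ → ℚ
  T j m = partialT j m (suc m)

  partialT-pascal : ∀ j m K → partialT j (suc m) (suc K) ≡ partialT j m (suc K) + partialT (suc j) m K
  partialT-pascal j m zero = sym (ℚP.+-identityʳ _)
  partialT-pascal j m (suc K) = begin
    partialT j (suc m) (suc K) + ℕ→ℚ (suc m C suc K) * cₖ
      ≡⟨ cong₂ (λ x y → x + ℕ→ℚ y * cₖ) (partialT-pascal j m K) (sym (nCk+nC[k+1]≡[n+1]C[k+1] m K)) ⟩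
    (A + B) + ℕ→ℚ (m C K ℕ.+ m C suc K) * cₖ
      ≡⟨ cong (λ x → (A + B) + x * cₖ) (ℕ→ℚ-homo-+ (m C K) (m C suc K)) ⟩
    (A + B) + (ℕ→ℚ (m C K) + ℕ→ℚ (m C suc K)) * cₖ
      ≡⟨ regroup A B (ℕ→ℚ (m C K)) (ℕ→ℚ (m C suc K)) cₖ ⟩
    (A + ℕ→ℚ (m C suc K) * cₖ) + (B + ℕ→ℚ (m C K) * cₖ)
      ≡⟨ cong (λ i → (A + ℕ→ℚ (m C suc K) * cₖ) + (B + ℕ→ℚ (m C K) * c i)) (ℕP.+-suc j K) ⟩
    partialT j m (suc (suc K)) + partialT (suc j) m (suc K)
      ∎
    where
    A = partialT j m (suc K)
    B = partialT (suc j) m K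
    cₖ = c (j ℕ.+ suc K)
    regroup : ∀ A B x y z → (A + B) + (x + y) * z ≡ (A + y * z) + (B + x * z)
    regroup = solve-∀ ℚ-ring

  T-pascal : ∀ j m → T j (suc m) ≡ T j m + T (suc j) m
  T-pascal j m = begin
    T j (suc m)                                     ≡⟨ partialT-pascal j m (suc m) ⟩
    (T j m + ℕ→ℚ (m C suc m) * cₘ) + T (suc j) m    ≡⟨ cong (λ x → (T j m + ℕ→ℚ x * cₘ) + T (suc j) m) (k>n⇒nCk≡0 (ℕP.n<1+n m)) ⟩
    (T j m + 0ℚ * cₘ) + T (suc j) m                 ≡⟨ cong (λ x → (T j m + x) + T (suc j) m) (ℚP.*-zeroˡ cₘ) ⟩
    (T j m + 0ℚ) + T (suc j) m                      ≡⟨ cong (_+ T (suc j) m) (ℚP.+-identityʳ (T j m)) ⟩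
    T j m + T (suc j) m                             ∎
    where cₘ = c (j ℕ.+ suc m)

  T-zero : ∀ j → T j 0 ≡ c j
  T-zero j = begin
    0ℚ + 1ℚ * c (j ℕ.+ 0) ≡⟨ ℚP.+-identityˡ _ ⟩
    1ℚ * c (j ℕ.+ 0)      ≡⟨ ℚP.*-identityˡ _ ⟩
    c (j ℕ.+ 0)           ≡⟨ cong c (ℕP.+-identityʳ j) ⟩
    c j                   ∎

  U : ℕ → ℕ → ℚ
  U j m = T j m - signPow (j ℕ.+ m) * T m j

  U-pascal : ∀ j m → U j (suc m) ≡ U j m + U (suc j) m
  U-pascal j m = begin
    T j (suc m) - signPow (j ℕ.+ suc m) * T (suc m) j
      ≡⟨ cong₂ (λ x n → x - signPow n * T (suc m) j) (T-pascal j m) (ℕP.+-suc j m) ⟩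
    (T j m + T (suc j) m) - - s * T (suc m) j
      ≡⟨ regroup s (T j m) (T (suc j) m) (T m j) (T (suc m) j) ⟩
    (T j m - s * T m j) + (T (suc j) m - - s * (T m j + T (suc m) j))
      ≡⟨ cong (λ x → U j m + (T (suc j) m - - s * x)) (T-pascal m j) ⟨
    U j m + U (suc j) m
      ∎
    where
    s = signPow (j ℕ.+ m)
    regroup : ∀ s a b p r → (a + b) - - s * r ≡ (a - s * p) + (b - - s * (p + r))
    regroup = solve-∀ ℚ-ring

  U-antisym : ∀ j m → U j m ≡ - (signPow (j ℕ.+ m) * U m j)
  U-antisym j m = begin
    T j m - s * T m j             ≡⟨ cong (_- s * T m j) (ℚP.*-identityˡ (T j m)) ⟨
    1ℚ * T j m - s * T m j        ≡⟨ cong (λ x → x * T j m - s * T m j) (signPow-square (j ℕ.+ m)) ⟨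
    (s * s) * T j m - s * T m j   ≡⟨ factor s (T j m) (T m j) ⟩
    - (s * (T m j - s * T j m))   ≡⟨ cong (λ n → - (s * (T m j - signPow n * T j m))) (ℕP.+-comm j m) ⟩
    - (s * U m j)                 ∎
    where
    s = signPow (j ℕ.+ m)
    factor : ∀ s a p → (s * s) * a - s * p ≡ - (s * (p - s * a))
    factor = solve-∀ ℚ-ring

  LevelVanishes : ℕ → Set
  LevelVanishes n = ∀ j m → j ℕ.+ m ≡ n → U j m ≡ 0ℚ

  U-slide : ∀ {n} → LevelVanishes n → ∀ j m → j ℕ.+ m ≡ suc n → U j m ≡ U (j ℕ.+ m) 0
  U-slide below j zero    _ = cong (λ k → U k 0) (sym (ℕP.+-identityʳ j))
  U-slide {n} below j (suc m) e = begin
    U j (suc m)           ≡⟨ U-pascal j m ⟩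
    U j m + U (suc j) m   ≡⟨ cong (_+ U (suc j) m) (below j m (ℕP.suc-injective e′)) ⟩
    0ℚ + U (suc j) m      ≡⟨ ℚP.+-identityˡ _ ⟩
    U (suc j) m           ≡⟨ U-slide below (suc j) m e′ ⟩
    U (suc j ℕ.+ m) 0     ≡⟨ cong (λ k → U k 0) (ℕP.+-suc j m) ⟨
    U (j ℕ.+ suc m) 0     ∎
    where
    e′ : suc j ℕ.+ m ≡ suc n
    e′ = trans (sym (ℕP.+-suc j m)) e

  U-even : ∀ n → LevelVanishes n → signPow (suc n) ≡ 1ℚ → U (suc n) 0 ≡ 0ℚ
  U-even n below even = x≡-x⇒x≡0 (begin
    U N 0                  ≡⟨ U-slide below 0 N refl ⟨
    U 0 N                  ≡⟨ U-antisym 0 N ⟩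
    - (signPow N * U N 0)  ≡⟨ cong (λ s → - (s * U N 0)) even ⟩
    - (1ℚ * U N 0)         ≡⟨ cong -_ (ℚP.*-identityˡ (U N 0)) ⟩
    - U N 0                ∎)
    where N = suc n

  U-odd : ∀ N → signPow N ≡ - 1ℚ → U N 0 ≡ c N + T 0 N
  U-odd N odd = begin
    T N 0 - signPow (N ℕ.+ 0) * T 0 N ≡⟨ cong₂ (λ t n → t - signPow n * T 0 N) (T-zero N) (ℕP.+-identityʳ N) ⟩
    c N - signPow N * T 0 N          ≡⟨ cong (λ s → c N - s * T 0 N) odd ⟩
    c N - - 1ℚ * T 0 N               ≡⟨ minus-neg (c N) (T 0 N) ⟩
    c N + T 0 N                      ∎
    where
    minus-neg : ∀ x y → x - - 1ℚ * y ≡ x + y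
    minus-neg = solve-∀ ℚ-ring

  module _ (odd-relation : ∀ N → signPow N ≡ - 1ℚ → c N + T 0 N ≡ 0ℚ) where

    U-top : ∀ n → LevelVanishes n → U (suc n) 0 ≡ 0ℚ
    U-top n below = [ U-even n below , (λ odd → trans (U-odd (suc n) odd) (odd-relation (suc n) odd)) ]′
                      (signPow-±1 (suc n))

    U-vanishes : ∀ n → LevelVanishes n
    U-vanishes zero    zero zero refl =
      trans (cong (λ x → T 0 0 - x) (ℚP.*-identityˡ (T 0 0))) (ℚP.+-inverseʳ (T 0 0))
    U-vanishes (suc n) j    m    e    =
      trans (U-slide (U-vanishes n) j m e) (trans (cong (λ k → U k 0) e) (U-top n (U-vanishes n)))

    T-reflection : ∀ j m → T j m ≡ signPow (j ℕ.+ m) * T m j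
    T-reflection j m = begin
      T j m           ≡⟨ sub-add (T j m) r ⟩
      U j m + r       ≡⟨ cong (_+ r) (U-vanishes (j ℕ.+ m) j m refl) ⟩
      0ℚ + r          ≡⟨ ℚP.+-identityˡ r ⟩
      r               ∎
      where
      r = signPow (j ℕ.+ m) * T m j
      sub-add : ∀ x y → x ≡ (x - y) + y
      sub-add = solve-∀ ℚ-ring

cM : ℤ → ℕ → ℚ
cM a k = (+ 1 / suc k) * bM a k

module _ (a : ℤ) where

  open BinomialTransform (cM a)

  bM-unfold : ∀ n → bM a n ≡ bStep a n (bTable a n)
  bM-unfold n with n ℕ.≟ n
  ... | yes _  = refl
  ... | no n≢n = ⊥-elim (n≢n refl)

  bTable-lookup : ∀ n k → k < n → bTable a n k ≡ bM a k
  bTable-lookup (suc n) k k<1+n with k ℕ.≟ n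
  ... | yes refl = sym (bM-unfold k)
  ... | no k≢n   = bTable-lookup n k (ℕP.≤∧≢⇒< (ℕP.≤-pred k<1+n) k≢n)

  bM-recurrence : ∀ n → let N = 3 ℕ.+ n in
                  bM a N ≡ - (½ * sumBelow N (λ k → bM a k * ℕ→ℚ (suc N C suc k)))
  bM-recurrence n = trans (bM-unfold (3 ℕ.+ n)) (cong (λ x → - (½ * x)) (sumBelow-cong (3 ℕ.+ n)
    (λ k k<N → cong (_* ℕ→ℚ (suc (3 ℕ.+ n) C suc k)) (bTable-lookup (3 ℕ.+ n) k k<N))))

  nCi*cᵢ≡[1+n]C[1+i]*bᵢ/[1+n] : ∀ n i →
    ℕ→ℚ (n C i) * cM a i ≡ (+ 1 / suc n) * (bM a i * ℕ→ℚ (suc n C suc i))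
  nCi*cᵢ≡[1+n]C[1+i]*bᵢ/[1+n] n i = begin
    X * (u * b)                ≡⟨ trans (cong (X * (u * b) *_) (1/[1+k]*[1+k]≡1 n)) (ℚP.*-identityʳ _) ⟨
    X * (u * b) * (v * Q)      ≡⟨ regroup₁ X u b v Q ⟩
    (v * (u * b)) * (Q * X)    ≡⟨ cong ((v * (u * b)) *_) absorption ⟩
    (v * (u * b)) * (P * Y)    ≡⟨ regroup₂ v u b P Y ⟩
    (v * (b * Y)) * (u * P)    ≡⟨ trans (cong ((v * (b * Y)) *_) (1/[1+k]*[1+k]≡1 i)) (ℚP.*-identityʳ _) ⟩
    v * (b * Y)                ∎
    where
    X = ℕ→ℚ (n C i)
    Y = ℕ→ℚ (suc n C suc i)
    u = + 1 / suc i
    v = + 1 / suc n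
    b = bM a i
    P = ℕ→ℚ (suc i)
    Q = ℕ→ℚ (suc n)
    absorption : Q * X ≡ P * Y
    absorption = begin
      Q * X                           ≡⟨ ℕ→ℚ-homo-* (suc n) (n C i) ⟨
      ℕ→ℚ (suc n ℕ.* (n C i))         ≡⟨ cong ℕ→ℚ ([1+k]*[1+n]C[1+k]≡[1+n]*nCk n i) ⟨
      ℕ→ℚ (suc i ℕ.* (suc n C suc i)) ≡⟨ ℕ→ℚ-homo-* (suc i) (suc n C suc i) ⟩
      P * Y                           ∎
    regroup₁ : ∀ X u b v Q → X * (u * b) * (v * Q) ≡ (v * (u * b)) * (Q * X)
    regroup₁ = solve-∀ ℚ-ring
    regroup₂ : ∀ v u b P Y → (v * (u * b)) * (P * Y) ≡ (v * (b * Y)) * (u * P)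
    regroup₂ = solve-∀ ℚ-ring

  cM+T₀≡0 : ∀ N → signPow N ≡ - 1ℚ → cM a N + T 0 N ≡ 0ℚ
  cM+T₀≡0 0 ()
  cM+T₀≡0 1 _ = refl  -- below the recurrence: c(1) + c(0) + c(1) = −½ + 1 − ½
  cM+T₀≡0 2 ()
  cM+T₀≡0 N@(suc (suc (suc n))) _ = begin
    cM a N + (partialT 0 N N + ℕ→ℚ (N C N) * cM a N)
      ≡⟨ cong₂ (λ x y → cM a N + (x + ℕ→ℚ y * cM a N))
               (sumBelow-cong N (λ i _ → nCi*cᵢ≡[1+n]C[1+i]*bᵢ/[1+n] N i)) (nCn≡1 N) ⟩
    v * bM a N + (sumBelow N (λ i → v * (bM a i * ℕ→ℚ (suc N C suc i))) + 1ℚ * (v * bM a N))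
      ≡⟨ cong (λ x → v * bM a N + (x + 1ℚ * (v * bM a N))) (*-distribˡ-sumBelow N v _) ⟨
    v * bM a N + (v * X + 1ℚ * (v * bM a N))
      ≡⟨ cong (λ y → v * y + (v * X + 1ℚ * (v * y))) (bM-recurrence n) ⟩
    v * - (½ * X) + (v * X + 1ℚ * (v * - (½ * X)))
      ≡⟨ cancel v X ⟩
    0ℚ
      ∎
    where
    v = + 1 / suc N
    X = sumBelow N (λ k → bM a k * ℕ→ℚ (suc N C suc k))
    cancel : ∀ v X → v * - (½ * X) + (v * X + 1ℚ * (v * - (½ * X))) ≡ 0ℚ
    cancel = solve-∀ ℚ-ring

  sM≡T : ∀ j m → sM a j (j ℕ.+ m) ≡ T j m
  sM≡T j m = trans (cong (λ K → sumBelow K term) length≡)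
                   (sumBelow-cong (suc m) (λ i i<1+m → term≡ i (ℕP.≤-pred i<1+m)))
    where
    term : ℕ → ℚ
    term i = (+ 1 / suc (j ℕ.+ i)) * ℕ→ℚ (((j ℕ.+ m) ∸ j) C ((j ℕ.+ m) ∸ (j ℕ.+ i))) * bM a (j ℕ.+ i)
    length≡ : suc (j ℕ.+ m) ∸ j ≡ suc m
    length≡ = trans (cong (_∸ j) (sym (ℕP.+-suc j m))) (ℕP.m+n∸m≡n j (suc m))
    binomial≡ : ∀ i → i ≤ m → ((j ℕ.+ m) ∸ j) C ((j ℕ.+ m) ∸ (j ℕ.+ i)) ≡ m C i
    binomial≡ i i≤m = trans (cong₂ _C_ (ℕP.m+n∸m≡n j m) (ℕP.[m+n]∸[m+o]≡n∸o j m i)) (sym (nCk≡nC[n∸k] i≤m))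
    swap : ∀ u x b → u * x * b ≡ x * (u * b)
    swap = solve-∀ ℚ-ring
    term≡ : ∀ i → i ≤ m → term i ≡ ℕ→ℚ (m C i) * cM a (j ℕ.+ i)
    term≡ i i≤m = trans (cong (λ x → (+ 1 / suc (j ℕ.+ i)) * ℕ→ℚ x * bM a (j ℕ.+ i)) (binomial≡ i i≤m))
                        (swap (+ 1 / suc (j ℕ.+ i)) (ℕ→ℚ (m C i)) (bM a (j ℕ.+ i)))

  sM-reflection : ∀ j m → sM a j (j ℕ.+ m) ≡ signPow (j ℕ.+ m) * sM a ((j ℕ.+ m) ∸ j) (j ℕ.+ m)
  sM-reflection j m = begin
    sM a j (j ℕ.+ m)
      ≡⟨ sM≡T j m ⟩
    T j m
      ≡⟨ T-reflection cM+T₀≡0 j m ⟩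
    signPow (j ℕ.+ m) * T m j
      ≡⟨ cong (signPow (j ℕ.+ m) *_) (sM≡T m j) ⟨
    signPow (j ℕ.+ m) * sM a m (m ℕ.+ j)
      ≡⟨ cong₂ (λ k d → signPow (j ℕ.+ m) * sM a k d) (sym (ℕP.m+n∸m≡n j m)) (ℕP.+-comm m j) ⟩
    signPow (j ℕ.+ m) * sM a ((j ℕ.+ m) ∸ j) (j ℕ.+ m)
      ∎

mainTheorem11 : (a : ℤ) → a ≤ℤ 0ℤ → (d j : ℕ) → j ≤ d →
    sM a j d ≡ signPow d * sM a (d ∸ j) d
mainTheorem11 a _ d j j≤d =
  let m , j+m≡d = ℕP.m≤n⇒∃[o]m+o≡n j≤d in
  subst (λ d → sM a j d ≡ signPow d * sM a (d ∸ j) d) j+m≡d (sM-reflection a j m)
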